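{- Let $\alpha \geq 1$ be an integer and let $v=[\ell_v,u_v]$ and $w=[\ell_w,u_w]$ be intervals of integers. Then $v^{[\alpha]} \cap w^{[\alpha]}$ is equal to one of the following sets: $\emptyset$, $v^{[\alpha]}$, $w^{[\alpha]}$, $\psi_{\alpha}(v,w)^{[\alpha]}$, $\varphi_{\alpha}(v,w)$, $\varphi_{\alpha}(w,v)$, $\varphi_{\alpha}(v,w) \mathbin{\dot{\cup}} \varphi_{\alpha}(w,v)$, $\varphi_{\alpha}(v,w) \mathbin{\dot{\cup}} \psi_{\alpha}(v,w)^{[\alpha]}$, $\varphi_{\alpha}(w,v) \mathbin{\dot{\cup}} \psi_{\alpha}(v,w)^{[\alpha]}$ (where $\dot\cup$ denotes a disjoint union).
   Context: For an integer $\alpha\ge 1$ and an integer $X$, $X^{[\alpha]}$ denotes $X \bmod \alpha \in [0,\alpha)$; for a set $X\subseteq\mathbb{Z}$, $X^{[\alpha]} = \{z \bmod \alpha : z \in X\}$. Intervals are sets of integers $[\ell,u]=\{z\in\mathbb{Z}:\ell\le z\le u\}$. For intervals $v=[\ell_v,u_v]$, $w=[\ell_w,u_w]$ define $\varphi_{\alpha}(v,w) = [\ell_v^{[\alpha]},u_w^{[\alpha]}]$ and $\psi_{\alpha}(v,w) = [\max\{\ell_v^{[\alpha]},\ell_w^{[\alpha]}\},\ \alpha+\min\{u_v^{[\alpha]},u_w^{[\alpha]}\}]$. -}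

module Defs where

open import Level using (0ℓ)
open import Data.Nat as ℕ using (ℕ; NonZero)
open import Data.Integer using (ℤ; +_; _+_; _≤_; _⊔_; _⊓_; _%ℕ_)
open import Data.Product using (_×_; ∃; Σ)
open import Data.Sum using (_⊎_)
open import Data.Empty using (⊥)
open import Relation.Binary.PropositionalEquality using (_≡_)

ZSet : Set₁
ZSet = ℤ → Set

∅ : ZSet
∅ _ = ⊥

_∩_ : ZSet → ZSet → ZSet
(A ∩ B) z = A z × B z

_∪_ : ZSet → ZSet → ZSet
(A ∪ B) z = A z ⊎ B z

_≐_ : ZSet → ZSet → Set
A ≐ B = ∀ z → (A z → B z) × (B z → A z)

Disjoint : ZSet → ZSet → Set
Disjoint A B = ∀ z → A z → B z → ⊥

_≐_∪̇_ : ZSet → ZSet → ZSet → Set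
X ≐ A ∪̇ B = Disjoint A B × (X ≐ (A ∪ B))

md : (α : ℕ) .{{_ : NonZero α}} → ℤ → ℤ
md α x = + (x %ℕ α)

⟦_,_⟧ : ℤ → ℤ → ZSet
⟦ ℓ , u ⟧ z = ℓ ≤ z × z ≤ u

modSet : (α : ℕ) .{{_ : NonZero α}} → ZSet → ZSet
modSet α X y = ∃ λ z → X z × y ≡ md α z

φ : (α : ℕ) .{{_ : NonZero α}} → (ℓv uv ℓw uw : ℤ) → ZSet
φ α ℓv uv ℓw uw = ⟦ md α ℓv , md α uw ⟧

ψ : (α : ℕ) .{{_ : NonZero α}} → (ℓv uv ℓw uw : ℤ) → ZSet
ψ α ℓv uv ℓw uw = ⟦ md α ℓv ⊔ md α ℓw , + α + (md α uv ⊓ md α uw) ⟧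

-- Reducing mod α, an interval [ℓ, ℓ + n] becomes {(a + k) mod α | k ≤ n} with
-- a = ℓ mod α.  This is all of [0, α) when n ≥ α; otherwise it is the arc from
-- a to b = (ℓ + n) mod α, which is either the interval [a, b] or, when it passes
-- α, the wrapped arc [a, α) ∪ [0, b] with b < a.  Intersecting such arcs is order
-- reasoning in ℕ: two intervals meet in [max ℓ, min u], which is v^{[α]}, w^{[α]},
-- φ(v,w) or φ(w,v); an interval and a wrapped arc meet in the interval or in
-- φ(v,w) ∪̇ φ(w,v); two wrapped arcs share the wrapped arc [max ℓ, α) ∪ [0, min u],
-- which is ψ(v,w)^{[α]}, plus the end piece φ(v,w) when ℓ_v^{[α]} ≤ u_w^{[α]}
-- (or φ(w,v) when ℓ_w^{[α]} ≤ u_v^{[α]}).  Exchanging v and w covers the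
-- remaining cases.
module Submission where

open import Defs
open import Level using (0ℓ)
open import Data.Nat as ℕ
  using (ℕ; NonZero; _≤_; _<_; _+_; _∸_; _%_; _⊔_; _⊓_; _≤?_; _<?_)
open import Data.Nat.Properties
open import Data.Nat.DivMod using (m≡m%n+[m/n]*n; m%n<n; m<n⇒m%n≡m; [m+n]%n≡m%n; m≤n⇒[n∸m]%m≡n%m)
open import Data.Integer as ℤ using (ℤ; +_; _%ℕ_; _/ℕ_; +≤+; +<+)
import Data.Integer.Properties as ℤP
open import Data.Integer.DivMod using (a≡a%ℕn+[a/ℕn]*n; n%ℕd<d)
open import Data.Integer.Tactic.RingSolver using (solve-∀)
open import Data.Product using (_×_; _,_; proj₁; proj₂; ∃) renaming (map to ×-map)
open import Data.Sum using (_⊎_; inj₁; inj₂) renaming (map to ⊎-map; swap to ⊎-swap)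
open import Data.Empty using (⊥-elim)
open import Function using (_∘′_)
open import Relation.Nullary using (Dec; yes; no)
open import Relation.Unary as U using (Pred; _⊆_)
open import Relation.Binary.PropositionalEquality

-- Residues of integers

%ℕ-unique : ∀ α .{{_ : NonZero α}} {i r} q → r < α → i ≡ + r ℤ.+ q ℤ.* + α → i %ℕ α ≡ r
%ℕ-unique α {i} {r} q r<α i≡r+qα = sym (ℤP.+-injective (ℤP.i-j≡0⇒i≡j (+ r) (+ r′) r-r′≡0))
  where
  r′ = i %ℕ α
  q′ = i /ℕ α

  r+qα≡r′+q′α : + r ℤ.+ q ℤ.* + α ≡ + r′ ℤ.+ q′ ℤ.* + α
  r+qα≡r′+q′α = trans (sym i≡r+qα) (a≡a%ℕn+[a/ℕn]*n i α)

  r-r′≡[q′-q]α : + r ℤ.- + r′ ≡ (q′ ℤ.- q) ℤ.* + α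
  r-r′≡[q′-q]α = begin
    + r ℤ.- + r′                                    ≡⟨ regroup (+ r) (+ r′) q (+ α) ⟩
    (+ r ℤ.+ q ℤ.* + α) ℤ.- (+ r′ ℤ.+ q ℤ.* + α)     ≡⟨ cong (ℤ._- (+ r′ ℤ.+ q ℤ.* + α)) r+qα≡r′+q′α ⟩
    (+ r′ ℤ.+ q′ ℤ.* + α) ℤ.- (+ r′ ℤ.+ q ℤ.* + α)   ≡⟨ factor (+ r′) q q′ (+ α) ⟩
    (q′ ℤ.- q) ℤ.* + α                              ∎
    where
    open ≡-Reasoning
    regroup : ∀ x y k m → x ℤ.- y ≡ (x ℤ.+ k ℤ.* m) ℤ.- (y ℤ.+ k ℤ.* m)
    regroup = solve-∀
    factor : ∀ y k k′ m → (y ℤ.+ k′ ℤ.* m) ℤ.- (y ℤ.+ k ℤ.* m) ≡ (k′ ℤ.- k) ℤ.* m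
    factor = solve-∀

  -- two remainders differ by less than α, so the multiple of α between them is 0
  ∣q′-q∣*α<α : ℤ.∣ q′ ℤ.- q ∣ ℕ.* α < 1 ℕ.* α
  ∣q′-q∣*α<α = begin-strict
    ℤ.∣ q′ ℤ.- q ∣ ℕ.* α       ≡⟨ ℤP.abs-* (q′ ℤ.- q) (+ α) ⟨
    ℤ.∣ (q′ ℤ.- q) ℤ.* + α ∣   ≡⟨ cong ℤ.∣_∣ r-r′≡[q′-q]α ⟨
    ℤ.∣ + r ℤ.- + r′ ∣         ≡⟨ cong ℤ.∣_∣ (ℤP.m-n≡m⊖n r r′) ⟩
    ℤ.∣ r ℤ.⊖ r′ ∣             ≤⟨ ℤP.∣m⊝n∣≤m⊔n r r′ ⟩
    r ⊔ r′                     <⟨ ⊔-lub r<α (n%ℕd<d i α) ⟩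
    α                          ≡⟨ *-identityˡ α ⟨
    1 ℕ.* α                    ∎
    where open ≤-Reasoning

  q′-q≡0 : q′ ℤ.- q ≡ + 0
  q′-q≡0 = ℤP.∣i∣≡0⇒i≡0 (n<1⇒n≡0 (*-cancelʳ-< α _ 1 ∣q′-q∣*α<α))

  r-r′≡0 : + r ℤ.- + r′ ≡ + 0
  r-r′≡0 = begin
    + r ℤ.- + r′        ≡⟨ r-r′≡[q′-q]α ⟩
    (q′ ℤ.- q) ℤ.* + α  ≡⟨ cong (ℤ._* + α) q′-q≡0 ⟩
    + 0 ℤ.* + α         ≡⟨⟩
    + 0                 ∎
    where open ≡-Reasoning

[i+k]%ℕn≡[i%ℕn+k]%n : ∀ α .{{_ : NonZero α}} i k → (i ℤ.+ + k) %ℕ α ≡ (i %ℕ α + k) % α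
[i+k]%ℕn≡[i%ℕn+k]%n α i k = %ℕ-unique α (q ℤ.+ + t) (m%n<n (a + k) α) i+k≡s+[q+t]α
  where
  a = i %ℕ α
  q = i /ℕ α
  s = (a + k) % α
  t = (a + k) ℕ./ α

  a+k≡s+tα : + a ℤ.+ + k ≡ + s ℤ.+ + t ℤ.* + α
  a+k≡s+tα = begin
    + a ℤ.+ + k          ≡⟨⟩
    + (a + k)            ≡⟨ cong +_ (m≡m%n+[m/n]*n (a + k) α) ⟩
    + (s + t ℕ.* α)      ≡⟨⟩
    + s ℤ.+ + (t ℕ.* α)  ≡⟨ cong (λ x → + s ℤ.+ x) (ℤP.pos-* t α) ⟩
    + s ℤ.+ + t ℤ.* + α  ∎
    where open ≡-Reasoning

  i+k≡s+[q+t]α : i ℤ.+ + k ≡ + s ℤ.+ (q ℤ.+ + t) ℤ.* + α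
  i+k≡s+[q+t]α = begin
    i ℤ.+ + k                              ≡⟨ cong (ℤ._+ + k) (a≡a%ℕn+[a/ℕn]*n i α) ⟩
    (+ a ℤ.+ q ℤ.* + α) ℤ.+ + k            ≡⟨ swap-k (+ a) q (+ α) (+ k) ⟩
    (+ a ℤ.+ + k) ℤ.+ q ℤ.* + α            ≡⟨ cong (ℤ._+ q ℤ.* + α) a+k≡s+tα ⟩
    (+ s ℤ.+ + t ℤ.* + α) ℤ.+ q ℤ.* + α    ≡⟨ collect (+ s) (+ t) q (+ α) ⟩
    + s ℤ.+ (q ℤ.+ + t) ℤ.* + α            ∎
    where
    open ≡-Reasoning
    swap-k : ∀ x y m z → (x ℤ.+ y ℤ.* m) ℤ.+ z ≡ (x ℤ.+ z) ℤ.+ y ℤ.* m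
    swap-k = solve-∀
    collect : ∀ x y z m → (x ℤ.+ y ℤ.* m) ℤ.+ z ℤ.* m ≡ x ℤ.+ (z ℤ.+ y) ℤ.* m
    collect = solve-∀

i≤j⇒j≡i+k : ∀ {i j} → i ℤ.≤ j → ∃ λ k → j ≡ i ℤ.+ + k
i≤j⇒j≡i+k {i} {j} i≤j = ℤ.∣ i ℤ.- j ∣ , (begin
  j                        ≡⟨ j≡i+[j-i] i j ⟩
  i ℤ.+ (j ℤ.- i)          ≡⟨ cong (λ x → i ℤ.+ x) (ℤP.∣-∣-≤ i≤j) ⟨
  i ℤ.+ + ℤ.∣ i ℤ.- j ∣    ∎)
  where
  open ≡-Reasoning
  j≡i+[j-i] : ∀ x y → y ≡ x ℤ.+ (y ℤ.- x)
  j≡i+[j-i] = solve-∀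

Between : ℕ → ℕ → Pred ℕ 0ℓ
Between a b r = a ≤ r × r ≤ b

Wrapped : ℕ → ℕ → ℕ → Pred ℕ 0ℓ
Wrapped α a b r = (a ≤ r × r < α) ⊎ r ≤ b

residues : (α : ℕ) .{{_ : NonZero α}} → ℕ → ℕ → Pred ℕ 0ℓ
residues α a n r = ∃ λ k → k ≤ n × r ≡ (a + k) % α

m%n≡m∸n : ∀ {m n} .{{_ : NonZero n}} → n ≤ m → m ∸ n < n → m % n ≡ m ∸ n
m%n≡m∸n n≤m m∸n<n = trans (sym (m≤n⇒[n∸m]%m≡n%m n≤m)) (m<n⇒m%n≡m m∸n<n)

m+n∸o<m : ∀ {m n o} → n < o → o ≤ m + n → m + n ∸ o < m
m+n∸o<m {m} {n} {o} n<o o≤m+n = subst (m + n ∸ o <_) (m+n∸n≡m m o) (∸-monoˡ-< (+-monoʳ-< m n<o) o≤m+n)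

residues-above : ∀ {α} .{{_ : NonZero α}} {a n r} → a ≤ r → r < α → r ≤ a + n → residues α a n r
residues-above {α} {a} {n} {r} a≤r r<α r≤a+n =
  r ∸ a , m≤n+o⇒m∸n≤o r a r≤a+n ,
  sym (trans (cong (_% α) (m+[n∸m]≡n a≤r)) (m<n⇒m%n≡m r<α))

residues-below : ∀ {α} .{{_ : NonZero α}} {a n r} → a < α → r < α → r + α ≤ a + n → residues α a n r
residues-below {α} {a} {n} {r} a<α r<α r+α≤a+n =
  r + α ∸ a , m≤n+o⇒m∸n≤o (r + α) a r+α≤a+n ,
  sym (begin
    (a + (r + α ∸ a)) % α  ≡⟨ cong (_% α) (m+[n∸m]≡n (≤-trans (<⇒≤ a<α) (m≤n+m α r))) ⟩
    (r + α) % α            ≡⟨ [m+n]%n≡m%n r α ⟩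
    r % α                  ≡⟨ m<n⇒m%n≡m r<α ⟩
    r                      ∎)
  where open ≡-Reasoning

residues-full : ∀ α .{{_ : NonZero α}} {a n} → a < α → α ≤ n → residues α a n U.≐ (_< α)
residues-full α {a} {n} a<α α≤n = (λ { (k , _ , refl) → m%n<n (a + k) α }) , reach
  where
  reach : (_< α) ⊆ residues α a n
  reach {r} r<α with a ≤? r
  ... | yes a≤r = residues-above a≤r r<α (≤-trans (<⇒≤ r<α) (≤-trans α≤n (m≤n+m n a)))
  ... | no a≰r  = residues-below a<α r<α (+-mono-≤ (<⇒≤ (≰⇒> a≰r)) α≤n)

residues-between : ∀ α .{{_ : NonZero α}} {a n} → a + n < α → residues α a n U.≐ Between a (a + n)
residues-between α {a} {n} a+n<α =
  inside , λ (a≤r , r≤a+n) → residues-above a≤r (≤-<-trans r≤a+n a+n<α) r≤a+n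
  where
  inside : residues α a n ⊆ Between a (a + n)
  inside (k , k≤n , refl) rewrite m<n⇒m%n≡m (≤-<-trans (+-monoʳ-≤ a k≤n) a+n<α) =
    m≤m+n a k , +-monoʳ-≤ a k≤n

residues-wrapped : ∀ α .{{_ : NonZero α}} {a n} → a < α → n < α → α ≤ a + n →
                   residues α a n U.≐ Wrapped α a (a + n ∸ α)
residues-wrapped α {a} {n} a<α n<α α≤a+n = inside , reach
  where
  a+n∸α<α : a + n ∸ α < α
  a+n∸α<α = <-trans (m+n∸o<m n<α α≤a+n) a<α

  inside : residues α a n ⊆ Wrapped α a (a + n ∸ α)
  inside (k , k≤n , refl) with a + k <? α
  ... | yes a+k<α rewrite m<n⇒m%n≡m a+k<α = inj₁ (m≤m+n a k , a+k<α)
  ... | no a+k≮α = inj₂ (≤-trans (≤-reflexive (m%n≡m∸n α≤a+k a+k∸α<α)) a+k∸α≤a+n∸α)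
    where
    α≤a+k = ≮⇒≥ a+k≮α
    a+k∸α≤a+n∸α = ∸-monoˡ-≤ α (+-monoʳ-≤ a k≤n)
    a+k∸α<α = ≤-<-trans a+k∸α≤a+n∸α a+n∸α<α

  reach : Wrapped α a (a + n ∸ α) ⊆ residues α a n
  reach (inj₁ (a≤r , r<α)) = residues-above a≤r r<α (≤-trans (<⇒≤ r<α) α≤a+n)
  reach (inj₂ r≤a+n∸α) = residues-below a<α (≤-<-trans r≤a+n∸α a+n∸α<α)
    (≤-trans (+-monoˡ-≤ α r≤a+n∸α) (≤-reflexive (m∸n+n≡m α≤a+n)))

-- Intersections of arcs

Between∩Between : ∀ a b c d → Between a b U.∩ Between c d U.≐ Between (a ⊔ c) (b ⊓ d)
Between∩Between a b c d =
  (λ ((a≤r , r≤b) , (c≤r , r≤d)) → ⊔-lub a≤r c≤r , ⊓-glb r≤b r≤d) ,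
  (λ (a⊔c≤r , r≤b⊓d) → (≤-trans (m≤m⊔n a c) a⊔c≤r , ≤-trans r≤b⊓d (m⊓n≤m b d)) ,
                       (≤-trans (m≤n⊔m a c) a⊔c≤r , ≤-trans r≤b⊓d (m⊓n≤n b d)))

⊆⇒∩≐ : ∀ {P Q : Pred ℕ 0ℓ} → P ⊆ Q → P U.∩ Q U.≐ P
⊆⇒∩≐ P⊆Q = proj₁ , λ p → p , P⊆Q p

Wrapped-mono : ∀ {α a a′ b b′} → a ≤ a′ → b′ ≤ b → Wrapped α a′ b′ ⊆ Wrapped α a b
Wrapped-mono a≤a′ _ (inj₁ (a′≤r , r<α)) = inj₁ (≤-trans a≤a′ a′≤r , r<α)
Wrapped-mono _ b′≤b (inj₂ r≤b′) = inj₂ (≤-trans r≤b′ b′≤b)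

Between⊥Between : ∀ {a b c d} → b < c → Between a b U.⊥ Between c d
Between⊥Between b<c ((_ , r≤b) , (c≤r , _)) = <⇒≱ b<c (≤-trans c≤r r≤b)

Between∩Wrapped : ∀ {α a b c d} → a < c → d < b → b < α →
                  Between a b U.∩ Wrapped α c d U.≐ Between a d U.∪ Between c b
Between∩Wrapped {α} {a} {b} {c} {d} a<c d<b b<α = split , join
  where
  split : Between a b U.∩ Wrapped α c d ⊆ Between a d U.∪ Between c b
  split ((a≤r , r≤b) , inj₁ (c≤r , _)) = inj₂ (c≤r , r≤b)
  split ((a≤r , r≤b) , inj₂ r≤d) = inj₁ (a≤r , r≤d)
  join : Between a d U.∪ Between c b ⊆ Between a b U.∩ Wrapped α c d
  join (inj₁ (a≤r , r≤d)) = (a≤r , ≤-trans r≤d (<⇒≤ d<b)) , inj₂ r≤d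
  join (inj₂ (c≤r , r≤b)) = (≤-trans (<⇒≤ a<c) c≤r , r≤b) , inj₁ (c≤r , ≤-<-trans r≤b b<α)

module _ {α a b c d : ℕ} (b<a : b < a) (d<c : d < c) where

  private
    tops : ∀ {r} → a ≤ r × r < α → c ≤ r × r < α → Wrapped α (a ⊔ c) (b ⊓ d) r
    tops (a≤r , r<α) (c≤r , _) = inj₁ (⊔-lub a≤r c≤r , r<α)

    bottoms : ∀ {r} → r ≤ b → r ≤ d → Wrapped α (a ⊔ c) (b ⊓ d) r
    bottoms r≤b r≤d = inj₂ (⊓-glb r≤b r≤d)

    both : Wrapped α (a ⊔ c) (b ⊓ d) ⊆ Wrapped α a b U.∩ Wrapped α c d
    both w = Wrapped-mono (m≤m⊔n a c) (m⊓n≤m b d) w , Wrapped-mono (m≤n⊔m a c) (m⊓n≤n b d) w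

  Wrapped∩Wrapped : d < a → b < c → Wrapped α a b U.∩ Wrapped α c d U.≐ Wrapped α (a ⊔ c) (b ⊓ d)
  Wrapped∩Wrapped d<a b<c = meet , both
    where
    meet : Wrapped α a b U.∩ Wrapped α c d ⊆ Wrapped α (a ⊔ c) (b ⊓ d)
    meet (inj₁ top , inj₁ top′) = tops top top′
    meet (inj₂ r≤b , inj₂ r≤d) = bottoms r≤b r≤d
    meet (inj₁ (a≤r , _) , inj₂ r≤d) = ⊥-elim (<⇒≱ d<a (≤-trans a≤r r≤d))
    meet (inj₂ r≤b , inj₁ (c≤r , _)) = ⊥-elim (<⇒≱ b<c (≤-trans c≤r r≤b))

  Wrapped∩Wrapped-overlap : d < α → a ≤ d →
    Wrapped α a b U.∩ Wrapped α c d U.≐ Between a d U.∪ Wrapped α (a ⊔ c) (b ⊓ d)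
  Wrapped∩Wrapped-overlap d<α a≤d = meet , join
    where
    meet : Wrapped α a b U.∩ Wrapped α c d ⊆ Between a d U.∪ Wrapped α (a ⊔ c) (b ⊓ d)
    meet (inj₁ top , inj₁ top′) = inj₂ (tops top top′)
    meet (inj₂ r≤b , inj₂ r≤d) = inj₂ (bottoms r≤b r≤d)
    meet (inj₁ (a≤r , _) , inj₂ r≤d) = inj₁ (a≤r , r≤d)
    meet (inj₂ r≤b , inj₁ (c≤r , _)) =
      ⊥-elim (<⇒≱ (<-trans b<a (≤-<-trans a≤d d<c)) (≤-trans c≤r r≤b))
    join : Between a d U.∪ Wrapped α (a ⊔ c) (b ⊓ d) ⊆ Wrapped α a b U.∩ Wrapped α c d
    join (inj₁ (a≤r , r≤d)) = inj₁ (a≤r , ≤-<-trans r≤d d<α) , inj₂ r≤d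
    join (inj₂ w) = both w

  Between⊥Wrapped : Between a d U.⊥ Wrapped α (a ⊔ c) (b ⊓ d)
  Between⊥Wrapped ((_ , r≤d) , inj₁ (a⊔c≤r , _)) =
    <⇒≱ d<c (≤-trans (m≤n⊔m a c) (≤-trans a⊔c≤r r≤d))
  Between⊥Wrapped ((a≤r , _) , inj₂ r≤b⊓d) =
    <⇒≱ b<a (≤-trans a≤r (≤-trans r≤b⊓d (m⊓n≤m b d)))

≐-sym : {A B : ZSet} → A ≐ B → B ≐ A
≐-sym A≐B z = proj₂ (A≐B z) , proj₁ (A≐B z)

≐-trans : {A B C : ZSet} → A ≐ B → B ≐ C → A ≐ C
≐-trans A≐B B≐C z = proj₁ (B≐C z) ∘′ proj₁ (A≐B z) , proj₂ (A≐B z) ∘′ proj₂ (B≐C z)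

∩-cong : {A A′ B B′ : ZSet} → A ≐ A′ → B ≐ B′ → (A ∩ B) ≐ (A′ ∩ B′)
∩-cong A≐A′ B≐B′ z =
  ×-map (proj₁ (A≐A′ z)) (proj₁ (B≐B′ z)) , ×-map (proj₂ (A≐A′ z)) (proj₂ (B≐B′ z))

∪-cong : {A A′ B B′ : ZSet} → A ≐ A′ → B ≐ B′ → (A ∪ B) ≐ (A′ ∪ B′)
∪-cong A≐A′ B≐B′ z =
  ⊎-map (proj₁ (A≐A′ z)) (proj₁ (B≐B′ z)) , ⊎-map (proj₂ (A≐A′ z)) (proj₂ (B≐B′ z))

∩-comm : {A B : ZSet} → (A ∩ B) ≐ (B ∩ A)
∩-comm z = (λ (x , y) → y , x) , (λ (y , x) → x , y)

≐∪̇-trans : {X Y A B : ZSet} → X ≐ Y → Y ≐ A ∪̇ B → X ≐ A ∪̇ B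
≐∪̇-trans X≐Y (A⊥B , Y≐A∪B) = A⊥B , ≐-trans X≐Y Y≐A∪B

≐∪̇-comm : {X A B : ZSet} → X ≐ A ∪̇ B → X ≐ B ∪̇ A
≐∪̇-comm (A⊥B , X≐A∪B) = (λ z b a → A⊥B z a b) , ≐-trans X≐A∪B (λ z → ⊎-swap , ⊎-swap)

⇑ : Pred ℕ 0ℓ → ZSet
⇑ P y = ∃ λ r → y ≡ + r × P r

⇑-cong : {P Q : Pred ℕ 0ℓ} → P U.≐ Q → ⇑ P ≐ ⇑ Q
⇑-cong (P⊆Q , Q⊆P) y = (λ (r , e , p) → r , e , P⊆Q p) , (λ (r , e , q) → r , e , Q⊆P q)

⟦+,+⟧≐⇑Between : ∀ a b → ⟦ + a , + b ⟧ ≐ ⇑ (Between a b)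
⟦+,+⟧≐⇑Between a b (+ r) =
  (λ { (+≤+ a≤r , +≤+ r≤b) → r , refl , a≤r , r≤b }) , λ { (_ , refl , a≤r , r≤b) → +≤+ a≤r , +≤+ r≤b }
⟦+,+⟧≐⇑Between a b ℤ.-[1+ r ] = (λ { (() , _) }) , λ { (_ , () , _) }

⇑∩⇑ : {P Q : Pred ℕ 0ℓ} → (⇑ P ∩ ⇑ Q) ≐ ⇑ (P U.∩ Q)
⇑∩⇑ {Q = Q} y = (λ { ((r , refl , p) , (s , e , q)) → r , refl , p , subst Q (sym (ℤP.+-injective e)) q }) ,
                (λ (r , e , p , q) → (r , e , p) , (r , e , q))

⇑∪⇑ : {P Q : Pred ℕ 0ℓ} → (⇑ P ∪ ⇑ Q) ≐ ⇑ (P U.∪ Q)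
⇑∪⇑ y = (λ { (inj₁ (r , e , p)) → r , e , inj₁ p ; (inj₂ (r , e , q)) → r , e , inj₂ q }) ,
        (λ { (r , e , inj₁ p) → inj₁ (r , e , p) ; (r , e , inj₂ q) → inj₂ (r , e , q) })

⇑-disjoint : {P Q : Pred ℕ 0ℓ} → P U.⊥ Q → Disjoint (⇑ P) (⇑ Q)
⇑-disjoint {Q = Q} P⊥Q y (r , refl , p) (s , e , q) = P⊥Q (p , subst Q (sym (ℤP.+-injective e)) q)

lift-∩ : {A B C : ZSet} {P Q R : Pred ℕ 0ℓ} →
         A ≐ ⇑ P → B ≐ ⇑ Q → P U.∩ Q U.≐ R → C ≐ ⇑ R → (A ∩ B) ≐ C
lift-∩ A≐P B≐Q P∩Q≐R C≐R =
  ≐-trans (∩-cong A≐P B≐Q) (≐-trans ⇑∩⇑ (≐-trans (⇑-cong P∩Q≐R) (≐-sym C≐R)))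

lift-∩-∪̇ : {A B C D : ZSet} {P Q R S : Pred ℕ 0ℓ} →
           A ≐ ⇑ P → B ≐ ⇑ Q → P U.∩ Q U.≐ R U.∪ S → R U.⊥ S →
           C ≐ ⇑ R → D ≐ ⇑ S → (A ∩ B) ≐ C ∪̇ D
lift-∩-∪̇ A≐P B≐Q P∩Q≐R∪S R⊥S C≐R D≐S =
  (λ z c d → ⇑-disjoint R⊥S z (proj₁ (C≐R z) c) (proj₁ (D≐S z) d)) ,
  lift-∩ A≐P B≐Q P∩Q≐R∪S (≐-trans (∪-cong C≐R D≐S) ⇑∪⇑)

-- Images of integer intervals

modSet⊆⇑< : ∀ α .{{_ : NonZero α}} {X : ZSet} y → modSet α X y → ⇑ (_< α) y
modSet⊆⇑< α y (z , _ , e) = z %ℕ α , e , n%ℕd<d z α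

modSet-offset : ∀ α .{{_ : NonZero α}} l n → modSet α ⟦ l , l ℤ.+ + n ⟧ ≐ ⇑ (residues α (l %ℕ α) n)
modSet-offset α l n y = image , preimage
  where
  image : modSet α ⟦ l , l ℤ.+ + n ⟧ y → ⇑ (residues α (l %ℕ α) n) y
  image (z , (l≤z , z≤l+n) , e) with i≤j⇒j≡i+k l≤z
  ... | k , refl = _ , trans e (cong +_ ([i+k]%ℕn≡[i%ℕn+k]%n α l k)) , k , k≤n , refl
    where
    k≤n = ≮⇒≥ λ n<k → ℤP.<⇒≱ (ℤP.+-monoʳ-< l (+<+ n<k)) z≤l+n
  preimage : ⇑ (residues α (l %ℕ α) n) y → modSet α ⟦ l , l ℤ.+ + n ⟧ y
  preimage (r , e , k , k≤n , refl) =
    l ℤ.+ + k , (ℤP.i≤i+j l (+ k) , ℤP.+-monoʳ-≤ l (+≤+ k≤n)) ,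
    trans e (cong +_ (sym ([i+k]%ℕn≡[i%ℕn+k]%n α l k)))

modSet-wrapped : ∀ α .{{_ : NonZero α}} l n {a} → l %ℕ α ≡ a → n < α → α ≤ a + n →
                 modSet α ⟦ l , l ℤ.+ + n ⟧ ≐ ⇑ (Wrapped α a (a + n ∸ α))
modSet-wrapped α l n refl n<α α≤a+n =
  ≐-trans (modSet-offset α l n) (⇑-cong (residues-wrapped α (n%ℕd<d l α) n<α α≤a+n))

modSet⟦M,α+m⟧≐⇑Wrapped : ∀ α .{{_ : NonZero α}} {M m} → m < M → M < α →
                          modSet α ⟦ + M , + α ℤ.+ + m ⟧ ≐ ⇑ (Wrapped α M m)
modSet⟦M,α+m⟧≐⇑Wrapped α {M} {m} m<M M<α =
  subst (λ u → modSet α ⟦ + M , u ⟧ ≐ ⇑ (Wrapped α M m)) (cong +_ M+n≡α+m)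
    (subst (λ y → modSet α ⟦ + M , + M ℤ.+ + n ⟧ ≐ ⇑ (Wrapped α M y)) M+n∸α≡m
      (modSet-wrapped α (+ M) n (m<n⇒m%n≡m M<α) n<α α≤M+n))
  where
  α≤α+m = m≤m+n α m
  n = α + m ∸ M
  M+n≡α+m : M + n ≡ α + m
  M+n≡α+m = m+[n∸m]≡n (≤-trans (<⇒≤ M<α) α≤α+m)
  M+n∸α≡m : M + n ∸ α ≡ m
  M+n∸α≡m = trans (cong (_∸ α) M+n≡α+m) (m+n∸m≡n α m)
  n<α : n < α
  n<α = subst (n <_) (m+n∸n≡m α M) (∸-monoˡ-< (+-monoʳ-< α m<M) (≤-trans (<⇒≤ M<α) α≤α+m))
  α≤M+n : α ≤ M + n
  α≤M+n = subst (α ≤_) (sym M+n≡α+m) α≤α+m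

data Shape (α : ℕ) .{{_ : NonZero α}} (a b : ℕ) (V : ZSet) : Set where
  empty   : V ≐ ∅ → Shape α a b V
  full    : V ≐ ⇑ (_< α) → Shape α a b V
  between : V ≐ ⇑ (Between a b) → Shape α a b V
  wrapped : b < a → V ≐ ⇑ (Wrapped α a b) → Shape α a b V

shape-offset : ∀ α .{{_ : NonZero α}} l n →
               Shape α (l %ℕ α) ((l %ℕ α + n) % α) (modSet α ⟦ l , l ℤ.+ + n ⟧)
shape-offset α l n = by-length (α ≤? n) (a + n <? α)
  where
  a = l %ℕ α
  a<α = n%ℕd<d l α
  V = modSet α ⟦ l , l ℤ.+ + n ⟧
  by-length : Dec (α ≤ n) → Dec (a + n < α) → Shape α a ((a + n) % α) V
  by-length (yes α≤n) _ = full (≐-trans (modSet-offset α l n) (⇑-cong (residues-full α a<α α≤n)))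
  by-length (no n≮α) (yes a+n<α) = subst (λ b → Shape α a b V) (sym (m<n⇒m%n≡m a+n<α))
    (between (≐-trans (modSet-offset α l n) (⇑-cong (residues-between α a+n<α))))
  by-length (no n≮α) (no a+n≮α) = subst (λ b → Shape α a b V) (sym (m%n≡m∸n α≤a+n (<-trans b<a a<α)))
    (wrapped b<a (modSet-wrapped α l n refl (≰⇒> n≮α) α≤a+n))
    where
    α≤a+n = ≮⇒≥ a+n≮α
    b<a = m+n∸o<m (≰⇒> n≮α) α≤a+n

shape : ∀ α .{{_ : NonZero α}} l u → Shape α (l %ℕ α) (u %ℕ α) (modSet α ⟦ l , u ⟧)
shape α l u with u ℤ.<? l
... | yes u<l = empty λ y → (λ (_ , (l≤z , z≤u) , _) → ℤP.<⇒≱ u<l (ℤP.≤-trans l≤z z≤u)) , λ ()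
... | no u≮l with i≤j⇒j≡i+k (ℤP.≮⇒≥ u≮l)
...   | n , refl = subst (λ b → Shape α (l %ℕ α) b (modSet α ⟦ l , l ℤ.+ + n ⟧))
                     (sym ([i+k]%ℕn≡[i%ℕn+k]%n α l n)) (shape-offset α l n)

-- The nine alternatives

module _ (α : ℕ) .{{_ : NonZero α}} (ℓv uv ℓw uw : ℤ) where

  private
    a = ℓv %ℕ α
    b = uv %ℕ α
    c = ℓw %ℕ α
    d = uw %ℕ α
    V = modSet α ⟦ ℓv , uv ⟧
    W = modSet α ⟦ ℓw , uw ⟧
    I = V ∩ W
    φvw = φ α ℓv uv ℓw uw
    φwv = φ α ℓw uw ℓv uv
    ψm = modSet α (ψ α ℓv uv ℓw uw)

  data Outcome : Set where
    ≐∅        : I ≐ ∅ → Outcome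
    ≐V        : I ≐ V → Outcome
    ≐W        : I ≐ W → Outcome
    ≐ψ        : I ≐ ψm → Outcome
    ≐φvw      : I ≐ φvw → Outcome
    ≐φwv      : I ≐ φwv → Outcome
    ≐φvw∪̇φwv : I ≐ φvw ∪̇ φwv → Outcome
    ≐φvw∪̇ψ   : I ≐ φvw ∪̇ ψm → Outcome
    ≐φwv∪̇ψ   : I ≐ φwv ∪̇ ψm → Outcome

  between∩between : V ≐ ⇑ (Between a b) → W ≐ ⇑ (Between c d) → Outcome
  between∩between V≐ W≐ = by-order (≤-total c a) (≤-total b d)
    where
    meet : ∀ {x y} {X : ZSet} → a ⊔ c ≡ x → b ⊓ d ≡ y → X ≐ ⇑ (Between x y) → I ≐ X
    meet a⊔c≡x b⊓d≡y =
      lift-∩ V≐ W≐ (subst₂ (λ x y → _ U.≐ Between x y) a⊔c≡x b⊓d≡y (Between∩Between a b c d))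
    by-order : c ≤ a ⊎ a ≤ c → b ≤ d ⊎ d ≤ b → Outcome
    by-order (inj₁ c≤a) (inj₁ b≤d) = ≐V (meet (m≥n⇒m⊔n≡m c≤a) (m≤n⇒m⊓n≡m b≤d) V≐)
    by-order (inj₁ c≤a) (inj₂ d≤b) = ≐φvw (meet (m≥n⇒m⊔n≡m c≤a) (m≥n⇒m⊓n≡n d≤b) (⟦+,+⟧≐⇑Between a d))
    by-order (inj₂ a≤c) (inj₁ b≤d) = ≐φwv (meet (m≤n⇒m⊔n≡n a≤c) (m≤n⇒m⊓n≡m b≤d) (⟦+,+⟧≐⇑Between c b))
    by-order (inj₂ a≤c) (inj₂ d≤b) = ≐W (meet (m≤n⇒m⊔n≡n a≤c) (m≥n⇒m⊓n≡n d≤b) W≐)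

  between∩wrapped : V ≐ ⇑ (Between a b) → d < c → W ≐ ⇑ (Wrapped α c d) → Outcome
  between∩wrapped V≐ d<c W≐ with c ≤? a | b ≤? d
  ... | yes c≤a | _ =
    ≐V (lift-∩ V≐ W≐ (⊆⇒∩≐ (λ (a≤r , r≤b) → inj₁ (≤-trans c≤a a≤r , ≤-<-trans r≤b b<α))) V≐)
    where b<α = n%ℕd<d uv α
  ... | no _ | yes b≤d = ≐V (lift-∩ V≐ W≐ (⊆⇒∩≐ (λ (_ , r≤b) → inj₂ (≤-trans r≤b b≤d))) V≐)
  ... | no c≰a | no b≰d = ≐φvw∪̇φwv
    (lift-∩-∪̇ V≐ W≐ (Between∩Wrapped (≰⇒> c≰a) (≰⇒> b≰d) (n%ℕd<d uv α)) (Between⊥Between d<c)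
      (⟦+,+⟧≐⇑Between a d) (⟦+,+⟧≐⇑Between c b))

  ψm≐⇑Wrapped : b < a → d < c → ψm ≐ ⇑ (Wrapped α (a ⊔ c) (b ⊓ d))
  ψm≐⇑Wrapped b<a d<c = modSet⟦M,α+m⟧≐⇑Wrapped α
    (≤-<-trans (m⊓n≤m b d) (<-≤-trans b<a (m≤m⊔n a c))) (⊔-lub (n%ℕd<d ℓv α) (n%ℕd<d ℓw α))

  wrapped∩wrapped : b < a → V ≐ ⇑ (Wrapped α a b) → d < c → W ≐ ⇑ (Wrapped α c d) →
                    d < a → b < c → Outcome
  wrapped∩wrapped b<a V≐ d<c W≐ d<a b<c =
    ≐ψ (lift-∩ V≐ W≐ (Wrapped∩Wrapped b<a d<c d<a b<c) (ψm≐⇑Wrapped b<a d<c))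

  wrapped∩wrapped-overlap : b < a → V ≐ ⇑ (Wrapped α a b) → d < c → W ≐ ⇑ (Wrapped α c d) →
                            a ≤ d → Outcome
  wrapped∩wrapped-overlap b<a V≐ d<c W≐ a≤d = ≐φvw∪̇ψ
    (lift-∩-∪̇ V≐ W≐ (Wrapped∩Wrapped-overlap b<a d<c (n%ℕd<d uw α) a≤d) (Between⊥Wrapped b<a d<c)
      (⟦+,+⟧≐⇑Between a d) (ψm≐⇑Wrapped b<a d<c))

ψ-comm : ∀ α .{{_ : NonZero α}} ℓv uv ℓw uw → ψ α ℓw uw ℓv uv ≡ ψ α ℓv uv ℓw uw
ψ-comm α ℓv uv ℓw uw =
  cong₂ ⟦_,_⟧ (ℤP.⊔-comm (md α ℓw) (md α ℓv)) (cong (λ x → + α ℤ.+ x) (ℤP.⊓-comm (md α uw) (md α uv)))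

Outcome-swap : ∀ α .{{_ : NonZero α}} ℓv uv ℓw uw → Outcome α ℓw uw ℓv uv → Outcome α ℓv uv ℓw uw
Outcome-swap α ℓv uv ℓw uw = flip
  where
  W∩V = modSet α ⟦ ℓw , uw ⟧ ∩ modSet α ⟦ ℓv , uv ⟧
  ψwv≡ψvw = ψ-comm α ℓv uv ℓw uw
  flip : Outcome α ℓw uw ℓv uv → Outcome α ℓv uv ℓw uw
  flip (≐∅ I≐) = ≐∅ (≐-trans ∩-comm I≐)
  flip (≐V I≐) = ≐W (≐-trans ∩-comm I≐)
  flip (≐W I≐) = ≐V (≐-trans ∩-comm I≐)
  flip (≐ψ I≐) = ≐ψ (≐-trans ∩-comm (subst (λ S → W∩V ≐ modSet α S) ψwv≡ψvw I≐))
  flip (≐φvw I≐) = ≐φwv (≐-trans ∩-comm I≐)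
  flip (≐φwv I≐) = ≐φvw (≐-trans ∩-comm I≐)
  flip (≐φvw∪̇φwv I≐) = ≐φvw∪̇φwv (≐∪̇-comm (≐∪̇-trans ∩-comm I≐))
  flip (≐φvw∪̇ψ I≐) =
    ≐φwv∪̇ψ (≐∪̇-trans ∩-comm (subst (λ S → W∩V ≐ φ α ℓw uw ℓv uv ∪̇ modSet α S) ψwv≡ψvw I≐))
  flip (≐φwv∪̇ψ I≐) =
    ≐φvw∪̇ψ (≐∪̇-trans ∩-comm (subst (λ S → W∩V ≐ φ α ℓv uv ℓw uw ∪̇ modSet α S) ψwv≡ψvw I≐))

∅-∩ : {A B : ZSet} → A ≐ ∅ → (A ∩ B) ≐ ∅
∅-∩ A≐∅ z = (λ (x , _) → proj₁ (A≐∅ z) x) , λ ()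

full-∩ : ∀ α .{{_ : NonZero α}} {A X : ZSet} → A ≐ ⇑ (_< α) → (A ∩ modSet α X) ≐ modSet α X
full-∩ α A≐ z = proj₂ , λ x → proj₂ (A≐ z) (modSet⊆⇑< α z x) , x

outcome : ∀ α .{{_ : NonZero α}} ℓv uv ℓw uw → Outcome α ℓv uv ℓw uw
outcome α ℓv uv ℓw uw with shape α ℓv uv | shape α ℓw uw
... | empty V≐∅      | _               = ≐∅ (∅-∩ V≐∅)
... | _              | empty W≐∅       = ≐∅ (≐-trans ∩-comm (∅-∩ W≐∅))
... | full V≐        | _               = ≐W (full-∩ α V≐)
... | _              | full W≐         = ≐V (≐-trans ∩-comm (full-∩ α W≐))
... | between V≐     | between W≐      = between∩between α ℓv uv ℓw uw V≐ W≐
... | between V≐     | wrapped d<c W≐  = between∩wrapped α ℓv uv ℓw uw V≐ d<c W≐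
... | wrapped b<a V≐ | between W≐      =
  Outcome-swap α ℓv uv ℓw uw (between∩wrapped α ℓw uw ℓv uv W≐ b<a V≐)
... | wrapped b<a V≐ | wrapped d<c W≐ with ℓv %ℕ α ≤? uw %ℕ α | ℓw %ℕ α ≤? uv %ℕ α
...   | yes a≤d | _       = wrapped∩wrapped-overlap α ℓv uv ℓw uw b<a V≐ d<c W≐ a≤d
...   | no _    | yes c≤b =
  Outcome-swap α ℓv uv ℓw uw (wrapped∩wrapped-overlap α ℓw uw ℓv uv d<c W≐ b<a V≐ c≤b)
...   | no a≰d  | no c≰b  = wrapped∩wrapped α ℓv uv ℓw uw b<a V≐ d<c W≐ (≰⇒> a≰d) (≰⇒> c≰b)

lemma4 : (α : ℕ) .{{_ : NonZero α}} (ℓv uv ℓw uw : ℤ) →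
    let V = modSet α ⟦ ℓv , uv ⟧
        W = modSet α ⟦ ℓw , uw ⟧
        I = V ∩ W
        φvw = φ α ℓv uv ℓw uw
        φwv = φ α ℓw uw ℓv uv
        ψm = modSet α (ψ α ℓv uv ℓw uw)
    in (I ≐ ∅) ⊎ (I ≐ V) ⊎ (I ≐ W) ⊎ (I ≐ ψm) ⊎ (I ≐ φvw) ⊎ (I ≐ φwv)
       ⊎ (I ≐ φvw ∪̇ φwv) ⊎ (I ≐ φvw ∪̇ ψm) ⊎ (I ≐ φwv ∪̇ ψm)
lemma4 α ℓv uv ℓw uw with outcome α ℓv uv ℓw uw
... | ≐∅ I≐        = inj₁ I≐
... | ≐V I≐        = inj₂ (inj₁ I≐)
... | ≐W I≐        = inj₂ (inj₂ (inj₁ I≐))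
... | ≐ψ I≐        = inj₂ (inj₂ (inj₂ (inj₁ I≐)))
... | ≐φvw I≐      = inj₂ (inj₂ (inj₂ (inj₂ (inj₁ I≐))))
... | ≐φwv I≐      = inj₂ (inj₂ (inj₂ (inj₂ (inj₂ (inj₁ I≐)))))
... | ≐φvw∪̇φwv I≐ = inj₂ (inj₂ (inj₂ (inj₂ (inj₂ (inj₂ (inj₁ I≐))))))
... | ≐φvw∪̇ψ I≐   = inj₂ (inj₂ (inj₂ (inj₂ (inj₂ (inj₂ (inj₂ (inj₁ I≐)))))))
... | ≐φwv∪̇ψ I≐   = inj₂ (inj₂ (inj₂ (inj₂ (inj₂ (inj₂ (inj₂ (inj₂ I≐)))))))
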